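{- Let $G=(V,E)$ be a finite undirected graph. The algorithm BronKerboschDegeneracy (described in the context) applied to $G$ reports every maximal clique of $G$, reports only maximal cliques of $G$, and reports each maximal clique exactly once.
   Context: For a vertex $v$, $\Gamma(v)=\{w : (v,w)\in E\}$ is its neighborhood. The degeneracy of $G$ is the smallest $d$ such that every nonempty subgraph of $G$ has a vertex of degree at most $d$; a degeneracy ordering is an ordering $v_0,v_1,\dots,v_{n-1}$ of $V$ in which every vertex has at most $d$ neighbors later in the ordering. A clique is maximal if it is not contained in a larger clique. Procedure BronKerboschPivot$(P,R,X)$, for disjoint vertex sets $P,R,X$: if $P\cup X=\emptyset$, report $R$ as a maximal clique. Then choose a pivot $u\in P\cup X$ maximizing $|P\cap\Gamma(u)|$ (pivot rule of Tomita et al.); for each vertex $v\in P\setminus\Gamma(u)$ (the set $P\setminus \Gamma(u)$ computed with respect to the current $P$ at loop start, $u$ itself counting as a non-neighbor), call BronKerboschPivot$(P\cap\Gamma(v),R\cup\{v\},X\cap\Gamma(v))$, then set $P\leftarrow P\setminus\{v\}$ and $X\leftarrow X\cup\{v\}$. Algorithm BronKerboschDegeneracy$(V,E)$: compute a degeneracy ordering $v_0,\dots,v_{n-1}$ of $G$; for each $i$ in order, let $P=\Gamma(v_i)\cap\{v_{i+1},\dots,v_{n-1}\}$ and $X=\Gamma(v_i)\cap\{v_0,\dots,v_{i-1}\}$ and call BronKerboschPivot$(P,\{v_i\},X)$. -}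

module Defs where

open import Data.Bool using (Bool; true; false)
open import Data.Nat using (ℕ; _≤_; _<ᵇ_)
open import Data.Fin using (Fin; toℕ)
open import Data.Fin.Subset using (Subset; _∈_; _∉_; _⊆_; _∩_; _∪_; _─_; _-_; ⁅_⁆; ∣_∣; Nonempty; ⊥)
open import Data.Fin.Permutation using (Permutation′; _⟨$⟩ʳ_; _⟨$⟩ˡ_)
open import Data.Vec using (tabulate)
open import Data.List using (List; []; _∷_; _++_; map; allFin; filter; length)
open import Data.List.Relation.Unary.Unique.Propositional using (Unique)
import Data.List.Membership.Propositional as LM
open import Data.Product using (Σ; ∃; _×_; _,_)
open import Relation.Binary.PropositionalEquality using (_≡_; _≢_)
open import Relation.Nullary using (¬_)
open import Relation.Binary.Definitions using (DecidableEquality)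
open import Data.Vec.Properties using (≡-dec)
import Data.Bool.Properties as BP

record Graph (n : ℕ) : Set where
  field
    adj    : Fin n → Fin n → Bool
    sym    : ∀ u w → adj u w ≡ adj w u
    irrefl : ∀ v → adj v v ≡ false
open Graph public

module _ {n : ℕ} (G : Graph n) where

  Γ : Fin n → Subset n
  Γ v = tabulate (adj G v)

  IsClique : Subset n → Set
  IsClique C = ∀ u w → u ∈ C → w ∈ C → u ≢ w → adj G u w ≡ true

  IsMaximalClique : Subset n → Set
  IsMaximalClique C = IsClique C × (∀ C′ → IsClique C′ → C ⊆ C′ → C′ ⊆ C)

  record Subgraph : Set where
    field
      S       : Subset n
      F       : Fin n → Fin n → Bool
      F-sym   : ∀ u w → F u w ≡ F w u
      F⊆E     : ∀ u w → F u w ≡ true → adj G u w ≡ true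
      F-inS   : ∀ u w → F u w ≡ true → u ∈ S

  degIn : Subgraph → Fin n → ℕ
  degIn H v = ∣ tabulate (Subgraph.F H v) ∣

  DegBound : ℕ → Set
  DegBound d = ∀ (H : Subgraph) → Nonempty (Subgraph.S H) →
               ∃ λ v → v ∈ Subgraph.S H × degIn H v ≤ d

  IsDegeneracy : ℕ → Set
  IsDegeneracy d = DegBound d × (∀ d′ → DegBound d′ → d ≤ d′)

  -- Orderings of V: a permutation σ; the vertex in position i is σ ⟨$⟩ʳ i,
  -- the position of vertex v is σ ⟨$⟩ˡ v.

  later : Permutation′ n → Fin n → Subset n
  later σ v = tabulate (λ w → toℕ (σ ⟨$⟩ˡ v) <ᵇ toℕ (σ ⟨$⟩ˡ w))

  earlier : Permutation′ n → Fin n → Subset n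
  earlier σ v = tabulate (λ w → toℕ (σ ⟨$⟩ˡ w) <ᵇ toℕ (σ ⟨$⟩ˡ v))

  IsDegeneracyOrdering : Permutation′ n → Set
  IsDegeneracyOrdering σ =
    ∃ λ d → IsDegeneracy d × (∀ v → ∣ Γ v ∩ later σ v ∣ ≤ d)

  -- Executions of BronKerboschPivot(P, R, X), as a relation between the
  -- arguments and the list of reported cliques (in the order reported).
  -- All admissible choices (pivot among ties, order in which the loop
  -- runs through P ∖ Γ(u)) are allowed.

  IsPivot : Subset n → Subset n → Fin n → Set
  IsPivot P X u = u ∈ (P ∪ X) × (∀ w → w ∈ (P ∪ X) → ∣ P ∩ Γ w ∣ ≤ ∣ P ∩ Γ u ∣)

  Enumerates : List (Fin n) → Subset n → Set
  Enumerates L A = Unique L × (∀ v → (v LM.∈ L → v ∈ A) × (v ∈ A → v LM.∈ L))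

  data BKPivot : Subset n → Subset n → Subset n → List (Subset n) → Set
  data BKLoop  : Subset n → Subset n → Subset n → List (Fin n) → List (Subset n) → Set

  data BKPivot where
    report : ∀ {P R X} → P ∪ X ≡ ⊥ → BKPivot P R X (R ∷ [])
    pivot  : ∀ {P R X u L out} → IsPivot P X u → Enumerates L (P ─ Γ u) →
             BKLoop P R X L out → BKPivot P R X out

  data BKLoop where
    done : ∀ {P R X} → BKLoop P R X [] []
    step : ∀ {P R X v vs o₁ o₂} →
           BKPivot (P ∩ Γ v) (R ∪ ⁅ v ⁆) (X ∩ Γ v) o₁ →
           BKLoop (P - v) R (X ∪ ⁅ v ⁆) vs o₂ →
           BKLoop P R X (v ∷ vs) (o₁ ++ o₂)

  data BKOuter (σ : Permutation′ n) : List (Fin n) → List (Subset n) → Set where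
    done : BKOuter σ [] []
    step : ∀ {v vs o₁ o₂} →
           BKPivot (Γ v ∩ later σ v) ⁅ v ⁆ (Γ v ∩ earlier σ v) o₁ →
           BKOuter σ vs o₂ →
           BKOuter σ (v ∷ vs) (o₁ ++ o₂)

  BKDegeneracy : Permutation′ n → List (Subset n) → Set
  BKDegeneracy σ out = BKOuter σ (map (σ ⟨$⟩ʳ_) (allFin n)) out

  _≟ₛ_ : DecidableEquality (Subset n)
  _≟ₛ_ = ≡-dec BP._≟_

  timesReported : Subset n → List (Subset n) → ℕ
  timesReported C out = length (filter (C ≟ₛ_) out)

module Submission where

-- A call BronKerboschPivot(P, R, X) is analysed through the classical
-- invariant Inv P R X: R is a clique, P and X are disjoint sets of common
-- neighbours of R lying outside R, and every common neighbour of R outside R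
-- lies in P ∪ X.  The *targets* of a call are the maximal cliques C with
-- R ⊆ C and C ∩ X = ∅.  By simultaneous induction on executions of a call
-- and of its loop we prove soundness (every reported clique is a target) and
-- exactness (every target is reported exactly once): a leaf P ∪ X = ∅ has R
-- as its only target; the loop step for v splits the targets into those
-- containing v (targets of the recursive call) and those avoiding v (targets
-- of the rest of the loop); and the pivot lemma shows that every target meets
-- the loop set P ∖ Γ(u).  Executions exist by recursion on |P|.  For the outer
-- loop, the targets of the call for v are exactly the maximal cliques whose
-- earliest vertex in the ordering is v, and every maximal clique of a nonempty
-- graph has exactly one earliest vertex.

open import Defs
open import Data.Nat using (ℕ; _≤_)
open import Data.Fin.Subset using (Subset)
open import Data.Fin.Permutation using (Permutation′)
open import Data.List using (List)
open import Data.List.Membership.Propositional using (_∈_)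
open import Data.Product using (∃; _×_)
open import Relation.Binary.PropositionalEquality using (_≡_)

open import Data.Nat using (zero; suc; _<_; _+_)
open import Data.Nat.Properties
  using (≤-refl; ≤-trans; <-≤-trans; ≤-<-trans; ≤-pred; n≮0; <ᵇ⇒<; <⇒<ᵇ; <-cmp; <-asym; <-irrefl)
open import Data.Bool using (Bool; true; false)
open import Data.Bool.Properties using (T-≡)
open import Data.Empty using (⊥-elim)
open import Data.Fin using (Fin; toℕ; Fin′; inject; fromℕ<)
open import Data.Fin.Properties using (toℕ-injective; toℕ-inject; toℕ-fromℕ<; ¬∀⟶∃¬; ¬∀⟶∃¬-smallest)
import Data.Fin as Fin
open import Data.Fin.Subset using (_∪_; _∩_; _─_; _-_; ⁅_⁆; ∣_∣; Nonempty; _⊆_)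
  renaming (_∈_ to _∈ₛ_; _∉_ to _∉ₛ_; ⊥ to ∅)
open import Data.Fin.Subset.Properties
  using ( _∈?_; nonempty?; Empty-unique; ∉⊥; ⊆-antisym; x∈⁅x⁆; x∈⁅y⁆⇒x≡y
        ; x∈p∪q⁺; x∈p∪q⁻; x∈p∩q⁺; x∈p∩q⁻; p─q⊆p; x∈p∧x∉q⇒x∈p─q; x∈p∧x≢y⇒x∈p-y
        ; ∣p─q∣≤∣p∣; x∈p⇒∣p-x∣<∣p∣; p⊆q⇒∣p∣≤∣q∣ )
open import Data.Fin.Permutation using (_⟨$⟩ʳ_; _⟨$⟩ˡ_; inverseʳ; inverseˡ)
open import Data.Vec using (_∷_; tabulate; here; there)
open import Data.Vec.Properties using (lookup∘tabulate; lookup⇒[]=; []=⇒lookup)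
open import Data.List using ([]; _∷_; _++_; map; allFin; filter; length)
open import Data.List.Properties using (filter-++; length-++)
open import Data.List.Relation.Unary.Any using (here; there)
import Data.List.Relation.Unary.All as All
open import Data.List.Relation.Unary.AllPairs using (_∷_)
open import Data.List.Relation.Unary.Unique.Propositional using (Unique)
open import Data.List.Relation.Unary.Unique.Propositional.Properties using (filter⁺; allFin⁺; map⁺)
open import Data.List.Membership.Propositional.Properties
  using (∈-filter⁺; ∈-filter⁻; ∈-allFin; ∈-map⁺; ∈-++⁻)
open import Data.List.Extrema.Nat using (argmax; argmax-all; f[xs]≤f[argmax])
open import Data.Product using (_,_; proj₁; proj₂)
open import Data.Sum using (_⊎_; inj₁; inj₂)
open import Function.Bundles using (Equivalence)
open import Relation.Binary.PropositionalEquality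
  using (refl; trans; cong; cong₂; subst; _≢_) renaming (sym to ≡-sym)
open import Relation.Nullary using (¬_; yes; no; ¬?)
open import Relation.Nullary.Decidable using (decidable-stable; _→-dec_)
open import Relation.Binary.Definitions using (tri<; tri≈; tri>)

∈-tabulate⁺ : ∀ {n} (f : Fin n → Bool) {w} → f w ≡ true → w ∈ₛ tabulate f
∈-tabulate⁺ f {w} fw = lookup⇒[]= w (tabulate f) (trans (lookup∘tabulate f w) fw)

∈-tabulate⁻ : ∀ {n} (f : Fin n → Bool) {w} → w ∈ₛ tabulate f → f w ≡ true
∈-tabulate⁻ f {w} w∈ = trans (≡-sym (lookup∘tabulate f w)) ([]=⇒lookup w∈)

∈─⇒∉ : ∀ {n} (p q : Subset n) {x} → x ∈ₛ p ─ q → x ∉ₛ q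
∈─⇒∉ (_ ∷ p) (true  ∷ q) {Fin.zero}  ()         _
∈─⇒∉ (_ ∷ p) (false ∷ q) {Fin.zero}  _          ()
∈─⇒∉ (_ ∷ p) (_     ∷ q) {Fin.suc x} (there x∈) (there x∈q) = ∈─⇒∉ p q x∈ x∈q

∪ˡ : ∀ {n} {p q : Subset n} {x} → x ∈ₛ p → x ∈ₛ p ∪ q
∪ˡ x∈ = x∈p∪q⁺ (inj₁ x∈)

∪ʳ : ∀ {n} {p q : Subset n} {x} → x ∈ₛ q → x ∈ₛ p ∪ q
∪ʳ x∈ = x∈p∪q⁺ (inj₂ x∈)

⁅⁆-unique : ∀ {n} (v : Fin n) {a b} → a ∈ₛ ⁅ v ⁆ → b ∈ₛ ⁅ v ⁆ → a ≡ b
⁅⁆-unique v a∈ b∈ = trans (x∈⁅y⁆⇒x≡y v a∈) (≡-sym (x∈⁅y⁆⇒x≡y v b∈))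

∈-tail : ∀ {a} {A : Set a} {v w : A} {L : List A} → w ∈ v ∷ L → w ≢ v → w ∈ L
∈-tail (here w≡v) w≢v = ⊥-elim (w≢v w≡v)
∈-tail (there w∈L) _  = w∈L

module Counting {n : ℕ} (G : Graph n) where

  count-++ : ∀ C xs ys →
             timesReported G C (xs ++ ys) ≡ timesReported G C xs + timesReported G C ys
  count-++ C xs ys =
    trans (cong length (filter-++ (_≟ₛ_ G C) xs ys)) (length-++ (filter (_≟ₛ_ G C) xs))

  count-absent : ∀ C xs → ¬ (C ∈ xs) → timesReported G C xs ≡ 0
  count-absent C []       _ = refl
  count-absent C (D ∷ xs) C∉ with _≟ₛ_ G C D
  ... | yes C≡D = ⊥-elim (C∉ (here C≡D))
  ... | no  _   = count-absent C xs (λ C∈ → C∉ (there C∈))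

  count-singleton : ∀ C → timesReported G C (C ∷ []) ≡ 1
  count-singleton C with _≟ₛ_ G C C
  ... | yes _   = refl
  ... | no  C≢C = ⊥-elim (C≢C refl)

-- Calls of BronKerboschPivot

module Calls {n : ℕ} (G : Graph n) where
  open Counting G

  private
    variable
      P R X C : Subset n
      u v w   : Fin n
      L       : List (Fin n)
      out     : List (Subset n)

  ∈Γ⁺ : adj G v w ≡ true → w ∈ₛ Γ G v
  ∈Γ⁺ {v} = ∈-tabulate⁺ (adj G v)

  ∈Γ⁻ : w ∈ₛ Γ G v → adj G v w ≡ true
  ∈Γ⁻ {v = v} = ∈-tabulate⁻ (adj G v)

  adj⇒≢ : adj G v w ≡ true → v ≢ w
  adj⇒≢ {v} vw refl with trans (≡-sym vw) (irrefl G v)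
  ... | ()

  ∉Γ-self : v ∉ₛ Γ G v
  ∉Γ-self v∈ = adj⇒≢ (∈Γ⁻ v∈) refl

  CommonNbr : Subset n → Fin n → Set
  CommonNbr R w = ∀ r → r ∈ₛ R → adj G r w ≡ true

  singleton-clique : ∀ v → IsClique G ⁅ v ⁆
  singleton-clique v a b a∈ b∈ a≢b = ⊥-elim (a≢b (⁅⁆-unique v a∈ b∈))

  clique-insert : IsClique G C → CommonNbr C v → IsClique G (C ∪ ⁅ v ⁆)
  clique-insert {C} {v} clC nbr a b a∈ b∈ a≢b with x∈p∪q⁻ C ⁅ v ⁆ a∈ | x∈p∪q⁻ C ⁅ v ⁆ b∈
  ... | inj₁ aC  | inj₁ bC  = clC a b aC bC a≢b
  ... | inj₁ aC  | inj₂ b=v rewrite x∈⁅y⁆⇒x≡y v b=v = nbr a aC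
  ... | inj₂ a=v | inj₁ bC  rewrite x∈⁅y⁆⇒x≡y v a=v = trans (Graph.sym G v b) (nbr b bC)
  ... | inj₂ a=v | inj₂ b=v = ⊥-elim (a≢b (⁅⁆-unique v a=v b=v))

  clique-common : IsClique G C → R ⊆ C → w ∈ₛ C → w ∉ₛ R → CommonNbr R w
  clique-common clC R⊆C w∈C w∉R r r∈R = clC r _ (R⊆C r∈R) w∈C (λ { refl → w∉R r∈R })

  -- A vertex outside a maximal clique C is non-adjacent to some vertex of C,
  -- for otherwise C ∪ {u} would be a larger clique.
  outside-maximal : IsMaximalClique G C → u ∉ₛ C → ∃ λ w → w ∈ₛ C × w ∉ₛ Γ G u
  outside-maximal {C} {u} (clC , maxC) u∉C
    with ¬∀⟶∃¬ n (λ w → w ∈ₛ C → w ∈ₛ Γ G u) (λ w → (w ∈? C) →-dec (w ∈? Γ G u)) all-adjacent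
    where
    all-adjacent : ¬ (∀ w → w ∈ₛ C → w ∈ₛ Γ G u)
    all-adjacent H = u∉C (maxC (C ∪ ⁅ u ⁆) (clique-insert clC nbr) ∪ˡ (∪ʳ (x∈⁅x⁆ u)))
      where
      nbr : CommonNbr C u
      nbr c c∈ = trans (Graph.sym G c u) (∈Γ⁻ (H c c∈))
  ... | w , ¬[w∈C⇒w∈Γu] with w ∈? C
  ...   | yes w∈C = w , w∈C , (λ w∈Γu → ¬[w∈C⇒w∈Γu] (λ _ → w∈Γu))
  ...   | no  w∉C = ⊥-elim (¬[w∈C⇒w∈Γu] (λ w∈C → ⊥-elim (w∉C w∈C)))

  -- In a graph with at least one vertex every maximal clique is nonempty,
  -- since the empty clique is contained in any singleton.
  maximal-nonempty : 1 ≤ n → IsMaximalClique G C → Nonempty C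
  maximal-nonempty {C} 1≤n (_ , maxC) with nonempty? C
  ... | yes ne = ne
  ... | no  ¬ne = ⊥-elim (¬ne (x₀ , maxC ⁅ x₀ ⁆ (singleton-clique x₀) C⊆⁅x₀⁆ (x∈⁅x⁆ x₀)))
    where
    x₀ : Fin n
    x₀ = fromℕ< 1≤n
    C⊆⁅x₀⁆ : C ⊆ ⁅ x₀ ⁆
    C⊆⁅x₀⁆ x∈C = ⊥-elim (¬ne (_ , x∈C))

  record Inv (P R X : Subset n) : Set where
    field
      clique   : IsClique G R
      P-common : w ∈ₛ P → CommonNbr R w
      X-common : w ∈ₛ X → CommonNbr R w
      P-fresh  : w ∈ₛ P → w ∉ₛ R
      X-fresh  : w ∈ₛ X → w ∉ₛ R
      complete : w ∉ₛ R → CommonNbr R w → w ∈ₛ P ⊎ w ∈ₛ X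
      disjoint : w ∈ₛ P → w ∉ₛ X
  open Inv

  inv-descend : Inv P R X → v ∈ₛ P → Inv (P ∩ Γ G v) (R ∪ ⁅ v ⁆) (X ∩ Γ G v)
  inv-descend {P} {R} {X} {v} I v∈P = record
    { clique   = clique-insert (clique I) (P-common I v∈P)
    ; P-common = λ w∈ → let (w∈P , w∈Γv) = x∈p∩q⁻ P _ w∈ in extend (P-common I w∈P) w∈Γv
    ; X-common = λ w∈ → let (w∈X , w∈Γv) = x∈p∩q⁻ X _ w∈ in extend (X-common I w∈X) w∈Γv
    ; P-fresh  = λ w∈ → let (w∈P , w∈Γv) = x∈p∩q⁻ P _ w∈ in fresh (P-fresh I w∈P) w∈Γv
    ; X-fresh  = λ w∈ → let (w∈X , w∈Γv) = x∈p∩q⁻ X _ w∈ in fresh (X-fresh I w∈X) w∈Γv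
    ; complete = complete′
    ; disjoint = λ w∈P′ w∈X′ → disjoint I (proj₁ (x∈p∩q⁻ P _ w∈P′)) (proj₁ (x∈p∩q⁻ X _ w∈X′))
    }
    where
    extend : CommonNbr R w → w ∈ₛ Γ G v → CommonNbr (R ∪ ⁅ v ⁆) w
    extend nbr w∈Γv r r∈ with x∈p∪q⁻ R ⁅ v ⁆ r∈
    ... | inj₁ r∈R = nbr r r∈R
    ... | inj₂ r=v rewrite x∈⁅y⁆⇒x≡y v r=v = ∈Γ⁻ w∈Γv
    fresh : w ∉ₛ R → w ∈ₛ Γ G v → w ∉ₛ R ∪ ⁅ v ⁆
    fresh w∉R w∈Γv w∈ with x∈p∪q⁻ R ⁅ v ⁆ w∈
    ... | inj₁ w∈R = w∉R w∈R
    ... | inj₂ w=v = adj⇒≢ (∈Γ⁻ w∈Γv) (≡-sym (x∈⁅y⁆⇒x≡y v w=v))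
    complete′ : w ∉ₛ R ∪ ⁅ v ⁆ → CommonNbr (R ∪ ⁅ v ⁆) w →
                w ∈ₛ P ∩ Γ G v ⊎ w ∈ₛ X ∩ Γ G v
    complete′ w∉ nbr with complete I (λ w∈R → w∉ (∪ˡ w∈R)) (λ r r∈R → nbr r (∪ˡ r∈R))
    ... | inj₁ w∈P = inj₁ (x∈p∩q⁺ (w∈P , ∈Γ⁺ (nbr v (∪ʳ (x∈⁅x⁆ v)))))
    ... | inj₂ w∈X = inj₂ (x∈p∩q⁺ (w∈X , ∈Γ⁺ (nbr v (∪ʳ (x∈⁅x⁆ v)))))

  inv-advance : Inv P R X → v ∈ₛ P → Inv (P - v) R (X ∪ ⁅ v ⁆)
  inv-advance {P} {R} {X} {v} I v∈P = record
    { clique   = clique I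
    ; P-common = λ w∈ → P-common I (p─q⊆p P _ w∈)
    ; X-common = X-common′
    ; P-fresh  = λ w∈ → P-fresh I (p─q⊆p P _ w∈)
    ; X-fresh  = X-fresh′
    ; complete = complete′
    ; disjoint = disjoint′
    }
    where
    X-common′ : w ∈ₛ X ∪ ⁅ v ⁆ → CommonNbr R w
    X-common′ w∈ with x∈p∪q⁻ X ⁅ v ⁆ w∈
    ... | inj₁ w∈X = X-common I w∈X
    ... | inj₂ w=v rewrite x∈⁅y⁆⇒x≡y v w=v = P-common I v∈P
    X-fresh′ : w ∈ₛ X ∪ ⁅ v ⁆ → w ∉ₛ R
    X-fresh′ w∈ with x∈p∪q⁻ X ⁅ v ⁆ w∈
    ... | inj₁ w∈X = X-fresh I w∈X
    ... | inj₂ w=v rewrite x∈⁅y⁆⇒x≡y v w=v = P-fresh I v∈P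
    complete′ : w ∉ₛ R → CommonNbr R w → w ∈ₛ P - v ⊎ w ∈ₛ X ∪ ⁅ v ⁆
    complete′ {w} w∉R nbr with complete I w∉R nbr
    ... | inj₂ w∈X = inj₂ (∪ˡ w∈X)
    ... | inj₁ w∈P with w Fin.≟ v
    ...   | yes refl = inj₂ (∪ʳ (x∈⁅x⁆ w))
    ...   | no  w≢v  = inj₁ (x∈p∧x≢y⇒x∈p-y w∈P w≢v)
    disjoint′ : w ∈ₛ P - v → w ∉ₛ X ∪ ⁅ v ⁆
    disjoint′ w∈P-v w∈ with x∈p∪q⁻ X ⁅ v ⁆ w∈
    ... | inj₁ w∈X = disjoint I (p─q⊆p P _ w∈P-v) w∈X
    ... | inj₂ w=v = ∈─⇒∉ P ⁅ v ⁆ w∈P-v w=v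

  -- At a leaf (P ∪ X = ∅) the clique R is maximal: a vertex of a clique
  -- C ⊇ R outside R would be a common neighbour of R, hence in P ∪ X.
  leaf-maximal : Inv P R X → P ∪ X ≡ ∅ → IsMaximalClique G R
  leaf-maximal {R = R} I empty = clique I , R-maximal
    where
    R-maximal : ∀ C → IsClique G C → R ⊆ C → C ⊆ R
    R-maximal C clC R⊆C {x} x∈C with x ∈? R
    ... | yes x∈R = x∈R
    ... | no  x∉R = ⊥-elim (∉⊥ (subst (x ∈ₛ_) empty
                      (x∈p∪q⁺ (complete I x∉R (clique-common clC R⊆C x∈C x∉R)))))

  -- Targets of a call: the maximal cliques it is responsible for

  record Target (C R X : Subset n) : Set where
    constructor target
    field
      maximal  : IsMaximalClique G C
      contains : R ⊆ C
      avoids   : w ∈ₛ X → w ∉ₛ C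
  open Target

  target-descend : Inv P R X → v ∈ₛ P →
                   Target C (R ∪ ⁅ v ⁆) (X ∩ Γ G v) → Target C R X × v ∈ₛ C
  target-descend {X = X} {v} {C} I v∈P (target mx R⊆C avoid) =
    target mx (λ r∈R → R⊆C (∪ˡ r∈R)) avoids′ , v∈C
    where
    v∈C : v ∈ₛ C
    v∈C = R⊆C (∪ʳ (x∈⁅x⁆ v))
    avoids′ : w ∈ₛ X → w ∉ₛ C
    avoids′ {w} w∈X w∈C with v Fin.≟ w
    ... | yes refl = disjoint I v∈P w∈X
    ... | no  v≢w  = avoid (x∈p∩q⁺ (w∈X , ∈Γ⁺ (proj₁ mx v w v∈C w∈C v≢w))) w∈C

  target-descend⁺ : Target C R X → v ∈ₛ C → Target C (R ∪ ⁅ v ⁆) (X ∩ Γ G v)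
  target-descend⁺ {C} {R} {X} {v} (target mx R⊆C avoid) v∈C =
    target mx R∪v⊆C (λ w∈ → avoid (proj₁ (x∈p∩q⁻ X _ w∈)))
    where
    R∪v⊆C : R ∪ ⁅ v ⁆ ⊆ C
    R∪v⊆C x∈ with x∈p∪q⁻ R ⁅ v ⁆ x∈
    ... | inj₁ x∈R = R⊆C x∈R
    ... | inj₂ x=v rewrite x∈⁅y⁆⇒x≡y v x=v = v∈C

  target-advance : Target C R (X ∪ ⁅ v ⁆) → Target C R X × v ∉ₛ C
  target-advance {v = v} (target mx R⊆C avoid) =
    target mx R⊆C (λ w∈X → avoid (∪ˡ w∈X)) , avoid (∪ʳ (x∈⁅x⁆ v))

  target-advance⁺ : Target C R X → v ∉ₛ C → Target C R (X ∪ ⁅ v ⁆)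
  target-advance⁺ {C} {X = X} {v} (target mx R⊆C avoid) v∉C = target mx R⊆C avoids′
    where
    avoids′ : w ∈ₛ X ∪ ⁅ v ⁆ → w ∉ₛ C
    avoids′ w∈ with x∈p∪q⁻ X ⁅ v ⁆ w∈
    ... | inj₁ w∈X = avoid w∈X
    ... | inj₂ w=v rewrite x∈⁅y⁆⇒x≡y v w=v = v∉C

  leaf-target : Inv P R X → P ∪ X ≡ ∅ → Target C R X → C ≡ R
  leaf-target I empty (target (clC , _) R⊆C _) =
    ⊆-antisym (proj₂ (leaf-maximal I empty) _ clC R⊆C) R⊆C

  P∪X-common : Inv P R X → w ∈ₛ P ∪ X → CommonNbr R w × w ∉ₛ R
  P∪X-common {P} {X = X} I w∈ with x∈p∪q⁻ P X w∈
  ... | inj₁ w∈P = P-common I w∈P , P-fresh I w∈P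
  ... | inj₂ w∈X = X-common I w∈X , X-fresh I w∈X

  target-in-P : Inv P R X → Target C R X → w ∈ₛ C → w ∉ₛ R → w ∈ₛ P
  target-in-P I (target (clC , _) R⊆C avoid) w∈C w∉R
    with complete I w∉R (clique-common clC R⊆C w∈C w∉R)
  ... | inj₁ w∈P = w∈P
  ... | inj₂ w∈X = ⊥-elim (avoid w∈X w∈C)

  -- Pivot lemma: for any u ∈ P ∪ X, every target meets P ∖ Γ(u).  If u ∈ C
  -- then u itself works; otherwise some w ∈ C is not adjacent to u, and such
  -- a w lies outside R, hence in P.
  pivot-hits : Inv P R X → u ∈ₛ P ∪ X → Target C R X → ∃ λ w → w ∈ₛ P ─ Γ G u × w ∈ₛ C
  pivot-hits {u = u} {C} I u∈P∪X t with P∪X-common I u∈P∪X | u ∈? C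
  ... | _ , u∉R | yes u∈C = u , x∈p∧x∉q⇒x∈p─q (target-in-P I t u∈C u∉R) ∉Γ-self , u∈C
  ... | u-nbr , _ | no u∉C =
    let (w , w∈C , w∉Γu) = outside-maximal (maximal t) u∉C
        w∉R = λ w∈R → w∉Γu (∈Γ⁺ (trans (Graph.sym G u w) (u-nbr w w∈R)))
    in w , x∈p∧x∉q⇒x∈p─q (target-in-P I t w∈C w∉R) w∉Γu , w∈C

  Candidates : Subset n → List (Fin n) → Set
  Candidates P L = Unique L × (∀ {v} → v ∈ L → v ∈ₛ P)

  enumerates⇒candidates : Enumerates G L (P ─ Γ G u) → Candidates P L
  enumerates⇒candidates {P = P} (uniq , elems) = uniq , λ v∈L → p─q⊆p P _ (proj₁ (elems _) v∈L)

  candidates-head : Candidates P (v ∷ L) → v ∈ₛ P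
  candidates-head (_ , ⊆P) = ⊆P (here refl)

  candidates-tail : Candidates P (v ∷ L) → Candidates (P - v) L
  candidates-tail (v∉L ∷ uniq , ⊆P) =
    uniq , λ w∈L → x∈p∧x≢y⇒x∈p-y (⊆P (there w∈L)) (λ w≡v → All.lookup v∉L w∈L (≡-sym w≡v))

  pivot-sound : Inv P R X → BKPivot G P R X out → C ∈ out → Target C R X
  loop-sound  : Inv P R X → Candidates P L → BKLoop G P R X L out → C ∈ out → Target C R X

  call-sound : Inv P R X → v ∈ₛ P → BKPivot G (P ∩ Γ G v) (R ∪ ⁅ v ⁆) (X ∩ Γ G v) out →
               C ∈ out → Target C R X × v ∈ₛ C
  call-sound I v∈P call C∈ = target-descend I v∈P (pivot-sound (inv-descend I v∈P) call C∈)

  rest-sound : Inv P R X → Candidates P (v ∷ L) → BKLoop G (P - v) R (X ∪ ⁅ v ⁆) L out →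
               C ∈ out → Target C R X × v ∉ₛ C
  rest-sound I cand rest C∈ =
    target-advance (loop-sound (inv-advance I (candidates-head cand)) (candidates-tail cand) rest C∈)

  pivot-sound I (report empty) (here refl) =
    target (leaf-maximal I empty) (λ r∈R → r∈R) (λ w∈X → X-fresh I w∈X)
  pivot-sound I (pivot _ enum loop) C∈ = loop-sound I (enumerates⇒candidates enum) loop C∈

  loop-sound I cand (step {o₁ = o₁} call rest) C∈ with ∈-++⁻ o₁ C∈
  ... | inj₁ C∈o₁ = proj₁ (call-sound I (candidates-head cand) call C∈o₁)
  ... | inj₂ C∈o₂ = proj₁ (rest-sound I cand rest C∈o₂)

  pivot-once : Inv P R X → BKPivot G P R X out → Target C R X → timesReported G C out ≡ 1
  loop-once  : Inv P R X → Candidates P L → BKLoop G P R X L out → Target C R X →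
               w ∈ L → w ∈ₛ C → timesReported G C out ≡ 1

  pivot-once {R = R} I (report empty) t =
    subst (λ D → timesReported G D (R ∷ []) ≡ 1) (≡-sym (leaf-target I empty t)) (count-singleton R)
  pivot-once I (pivot (u∈P∪X , _) enum@(_ , elems) loop) t =
    let (w , w∈P─Γu , w∈C) = pivot-hits I u∈P∪X t
    in loop-once I (enumerates⇒candidates enum) loop t (proj₂ (elems w) w∈P─Γu) w∈C

  -- Split on whether the target contains the loop vertex v: if so it is
  -- reported once by the recursive call and never by the rest of the loop,
  -- otherwise the other way round.
  loop-once {C = C} I cand (step {v = v} {o₁ = o₁} {o₂} call rest) t w∈L w∈C with v ∈? C
  ... | yes v∈C = trans (count-++ C o₁ o₂) (cong₂ _+_
        (pivot-once (inv-descend I (candidates-head cand)) call (target-descend⁺ t v∈C))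
        (count-absent C o₂ λ C∈o₂ → proj₂ (rest-sound I cand rest C∈o₂) v∈C))
  ... | no  v∉C = trans (count-++ C o₁ o₂) (cong₂ _+_
        (count-absent C o₁ λ C∈o₁ → v∉C (proj₂ (call-sound I (candidates-head cand) call C∈o₁)))
        (loop-once (inv-advance I (candidates-head cand)) (candidates-tail cand) rest
                   (target-advance⁺ t v∉C) (∈-tail w∈L (λ { refl → v∉C w∈C })) w∈C))

  -- Every call has an execution

  elements : Subset n → List (Fin n)
  elements A = filter (_∈? A) (allFin n)

  elements-enumerates : ∀ A → Enumerates G (elements A) A
  elements-enumerates A =
    filter⁺ (_∈? A) (allFin⁺ n) ,
    λ v → (λ v∈ → proj₂ (∈-filter⁻ (_∈? A) {xs = allFin n} v∈)) , ∈-filter⁺ (_∈? A) (∈-allFin v)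

  pivot-exists : ∀ P X → Nonempty (P ∪ X) → ∃ (IsPivot G P X)
  pivot-exists P X (x , x∈) =
    best , argmax-all score x∈ (All.tabulate (λ w∈ws → proj₁ (elems _) w∈ws)) ,
    λ w w∈ → All.lookup (f[xs]≤f[argmax] {f = score} x ws) (proj₂ (elems w) w∈)
    where
    score : Fin n → ℕ
    score w = ∣ P ∩ Γ G w ∣
    ws : List (Fin n)
    ws = elements (P ∪ X)
    elems : ∀ w → (w ∈ ws → w ∈ₛ P ∪ X) × (w ∈ₛ P ∪ X → w ∈ ws)
    elems = proj₂ (elements-enumerates (P ∪ X))
    best : Fin n
    best = argmax score x ws

  descend-smaller : v ∈ₛ P → ∣ P ∩ Γ G v ∣ < ∣ P ∣
  descend-smaller {v} {P} v∈P = ≤-<-trans (p⊆q⇒∣p∣≤∣q∣ P∩Γv⊆P-v) (x∈p⇒∣p-x∣<∣p∣ v∈P)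
    where
    P∩Γv⊆P-v : P ∩ Γ G v ⊆ P - v
    P∩Γv⊆P-v w∈ = let (w∈P , w∈Γv) = x∈p∩q⁻ P _ w∈
                  in x∈p∧x≢y⇒x∈p-y w∈P (λ w≡v → adj⇒≢ (∈Γ⁻ w∈Γv) (≡-sym w≡v))

  -- Recursion on a bound m for |P|.
  run-pivot : ∀ m P R X → ∣ P ∣ ≤ m → ∃ (BKPivot G P R X)
  run-loop  : ∀ m P R X L → ∣ P ∣ ≤ m → Candidates P L → ∃ (BKLoop G P R X L)

  run-pivot m P R X |P|≤m with nonempty? (P ∪ X)
  ... | no  empty = _ , report (Empty-unique empty)
  ... | yes ne    =
    let (u , piv) = pivot-exists P X ne
        enum      = elements-enumerates (P ─ Γ G u)
        (out , loop) = run-loop m P R X _ |P|≤m (enumerates⇒candidates enum)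
    in out , pivot piv enum loop

  run-loop m       P R X []       _     _    = [] , done
  run-loop zero    P R X (v ∷ L) |P|≤0 cand =
    ⊥-elim (n≮0 (<-≤-trans (x∈p⇒∣p-x∣<∣p∣ (candidates-head cand)) |P|≤0))
  run-loop (suc m) P R X (v ∷ L) |P|≤m cand =
    let (o₁ , call) = run-pivot m (P ∩ Γ G v) (R ∪ ⁅ v ⁆) (X ∩ Γ G v)
                        (≤-pred (<-≤-trans (descend-smaller (candidates-head cand)) |P|≤m))
        (o₂ , rest) = run-loop (suc m) (P - v) R (X ∪ ⁅ v ⁆) L
                        (≤-trans (∣p─q∣≤∣p∣ P _) |P|≤m) (candidates-tail cand)
    in o₁ ++ o₂ , step call rest

-- The outer loop along a vertex ordering

module Outer {n : ℕ} (G : Graph n) (σ : Permutation′ n) where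
  open Counting G
  open Calls G

  private
    variable
      C     : Subset n
      v w   : Fin n
      L     : List (Fin n)
      out   : List (Subset n)

  pos : Fin n → ℕ
  pos v = toℕ (σ ⟨$⟩ˡ v)

  vertex-at : ∀ {i} w → toℕ i ≡ pos w → σ ⟨$⟩ʳ i ≡ w
  vertex-at w i≡pos = trans (cong (σ ⟨$⟩ʳ_) (toℕ-injective i≡pos)) (inverseʳ σ)

  pos-injective : pos v ≡ pos w → v ≡ w
  pos-injective {w = w} eq = trans (≡-sym (inverseʳ σ)) (vertex-at w eq)

  ∈later⁺ : pos v < pos w → w ∈ₛ later G σ v
  ∈later⁺ lt = ∈-tabulate⁺ _ (Equivalence.to T-≡ (<⇒<ᵇ lt))

  ∈later⁻ : w ∈ₛ later G σ v → pos v < pos w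
  ∈later⁻ {w} {v} w∈ = <ᵇ⇒< (pos v) (pos w) (Equivalence.from T-≡ (∈-tabulate⁻ _ w∈))

  ∈earlier⁺ : pos w < pos v → w ∈ₛ earlier G σ v
  ∈earlier⁺ lt = ∈-tabulate⁺ _ (Equivalence.to T-≡ (<⇒<ᵇ lt))

  ∈earlier⁻ : w ∈ₛ earlier G σ v → pos w < pos v
  ∈earlier⁻ {w} {v} w∈ = <ᵇ⇒< (pos w) (pos v) (Equivalence.from T-≡ (∈-tabulate⁻ _ w∈))

  outer-inv : ∀ v → Inv (Γ G v ∩ later G σ v) ⁅ v ⁆ (Γ G v ∩ earlier G σ v)
  outer-inv v = record
    { clique   = singleton-clique v
    ; P-common = λ w∈ → common (proj₁ (x∈p∩q⁻ _ _ w∈))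
    ; X-common = λ w∈ → common (proj₁ (x∈p∩q⁻ _ _ w∈))
    ; P-fresh  = λ w∈ → fresh (proj₁ (x∈p∩q⁻ _ _ w∈))
    ; X-fresh  = λ w∈ → fresh (proj₁ (x∈p∩q⁻ _ _ w∈))
    ; complete = complete′
    ; disjoint = λ w∈P w∈X → <-asym (∈later⁻ (proj₂ (x∈p∩q⁻ _ _ w∈P)))
                                    (∈earlier⁻ (proj₂ (x∈p∩q⁻ _ _ w∈X)))
    }
    where
    common : w ∈ₛ Γ G v → CommonNbr ⁅ v ⁆ w
    common w∈Γv r r∈ rewrite x∈⁅y⁆⇒x≡y v r∈ = ∈Γ⁻ w∈Γv
    fresh : w ∈ₛ Γ G v → w ∉ₛ ⁅ v ⁆
    fresh w∈Γv w∈ = ∉Γ-self (subst (_∈ₛ Γ G v) (x∈⁅y⁆⇒x≡y v w∈) w∈Γv)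
    complete′ : w ∉ₛ ⁅ v ⁆ → CommonNbr ⁅ v ⁆ w →
                w ∈ₛ Γ G v ∩ later G σ v ⊎ w ∈ₛ Γ G v ∩ earlier G σ v
    complete′ {w} w∉ nbr with <-cmp (pos v) (pos w)
    ... | tri< lt _ _ = inj₁ (x∈p∩q⁺ (∈Γ⁺ (nbr v (x∈⁅x⁆ v)) , ∈later⁺ lt))
    ... | tri≈ _ eq _ = ⊥-elim (w∉ (subst (_∈ₛ ⁅ v ⁆) (pos-injective eq) (x∈⁅x⁆ v)))
    ... | tri> _ _ gt = inj₂ (x∈p∩q⁺ (∈Γ⁺ (nbr v (x∈⁅x⁆ v)) , ∈earlier⁺ gt))

  Earliest : Subset n → Fin n → Set
  Earliest C v = v ∈ₛ C × (∀ {w} → w ∈ₛ C → w ∉ₛ earlier G σ v)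

  outer-target⁻ : Target C ⁅ v ⁆ (Γ G v ∩ earlier G σ v) → IsMaximalClique G C × Earliest C v
  outer-target⁻ {C} {v} (target mx ⁅v⁆⊆C avoid) = mx , v∈C , none-earlier
    where
    v∈C : v ∈ₛ C
    v∈C = ⁅v⁆⊆C (x∈⁅x⁆ v)
    none-earlier : w ∈ₛ C → w ∉ₛ earlier G σ v
    none-earlier {w} w∈C w∈E with v Fin.≟ w
    ... | yes refl = <-irrefl refl (∈earlier⁻ w∈E)
    ... | no  v≢w  = avoid (x∈p∩q⁺ (∈Γ⁺ (proj₁ mx v w v∈C w∈C v≢w) , w∈E)) w∈C

  outer-target⁺ : IsMaximalClique G C → Earliest C v → Target C ⁅ v ⁆ (Γ G v ∩ earlier G σ v)
  outer-target⁺ {C} {v} mx (v∈C , none-earlier) =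
    target mx (λ x∈ → subst (_∈ₛ C) (≡-sym (x∈⁅y⁆⇒x≡y v x∈)) v∈C)
              (λ w∈ w∈C → none-earlier w∈C (proj₂ (x∈p∩q⁻ _ _ w∈)))

  earliest-unique : Earliest C v → Earliest C w → v ≡ w
  earliest-unique {v = v} {w} (v∈C , v-first) (w∈C , w-first) with <-cmp (pos v) (pos w)
  ... | tri< lt _ _ = ⊥-elim (w-first v∈C (∈earlier⁺ lt))
  ... | tri≈ _ eq _ = pos-injective eq
  ... | tri> _ _ gt = ⊥-elim (v-first w∈C (∈earlier⁺ gt))

  -- Every nonempty set has an earliest vertex: the vertex of C at the
  -- smallest position occupied by C.
  earliest-exists : Nonempty C → ∃ (Earliest C)
  earliest-exists {C} (x , x∈C)
    with ¬∀⟶∃¬-smallest n (λ i → σ ⟨$⟩ʳ i ∉ₛ C) (λ i → ¬? ((σ ⟨$⟩ʳ i) ∈? C)) occupied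
    where
    occupied : ¬ (∀ i → σ ⟨$⟩ʳ i ∉ₛ C)
    occupied H = H (σ ⟨$⟩ˡ x) (subst (_∈ₛ C) (≡-sym (inverseʳ σ)) x∈C)
  ... | i , ¬¬σi∈C , before-i-free = σ ⟨$⟩ʳ i , decidable-stable ((σ ⟨$⟩ʳ i) ∈? C) ¬¬σi∈C , none-earlier
    where
    none-earlier : w ∈ₛ C → w ∉ₛ earlier G σ (σ ⟨$⟩ʳ i)
    none-earlier {w} w∈C w∈E = before-i-free k (subst (_∈ₛ C) (≡-sym (vertex-at w k≡pos)) w∈C)
      where
      lt : pos w < toℕ i
      lt = subst (pos w <_) (cong toℕ (inverseˡ σ)) (∈earlier⁻ w∈E)
      k : Fin′ i
      k = fromℕ< lt
      k≡pos : toℕ (inject k) ≡ pos w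
      k≡pos = trans (toℕ-inject k) (toℕ-fromℕ< lt)

  outer-sound : BKOuter G σ L out → C ∈ out →
                IsMaximalClique G C × ∃ λ v → v ∈ L × Earliest C v
  outer-sound (step {v = v} {o₁ = o₁} call rest) C∈ with ∈-++⁻ o₁ C∈
  ... | inj₁ C∈o₁ = let (mx , e) = outer-target⁻ (pivot-sound (outer-inv v) call C∈o₁)
                    in mx , v , here refl , e
  ... | inj₂ C∈o₂ = let (mx , w , w∈L , e) = outer-sound rest C∈o₂
                    in mx , w , there w∈L , e

  outer-once : Unique L → BKOuter G σ L out → IsMaximalClique G C →
               v ∈ L → Earliest C v → timesReported G C out ≡ 1
  outer-once {C = C} {v = v} (v′∉L ∷ uniq) (step {v = v′} {o₁ = o₁} {o₂} call rest) mx v∈ e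
    with v Fin.≟ v′
  ... | yes refl = trans (count-++ C o₁ o₂) (cong₂ _+_
        (pivot-once (outer-inv v) call (outer-target⁺ mx e))
        (count-absent C o₂ λ C∈o₂ →
          let (_ , w , w∈L , e′) = outer-sound rest C∈o₂
          in All.lookup v′∉L w∈L (earliest-unique e e′)))
  ... | no  v≢v′ = trans (count-++ C o₁ o₂) (cong₂ _+_
        (count-absent C o₁ λ C∈o₁ →
          v≢v′ (earliest-unique e (proj₂ (outer-target⁻ (pivot-sound (outer-inv v′) call C∈o₁)))))
        (outer-once uniq rest mx (∈-tail v∈ v≢v′) e))

  run-outer : ∀ L → ∃ (BKOuter G σ L)
  run-outer []      = [] , done
  run-outer (v ∷ L) =
    let (o₁ , call) = run-pivot _ (Γ G v ∩ later G σ v) ⁅ v ⁆ (Γ G v ∩ earlier G σ v) ≤-refl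
        (o₂ , rest) = run-outer L
    in o₁ ++ o₂ , step call rest

  order : List (Fin n)
  order = map (σ ⟨$⟩ʳ_) (allFin n)

  order-unique : Unique order
  order-unique = map⁺ (λ eq → trans (≡-sym (inverseˡ σ)) (trans (cong (σ ⟨$⟩ˡ_) eq) (inverseˡ σ)))
                      (allFin⁺ n)

  ∈-order : ∀ v → v ∈ order
  ∈-order v = subst (_∈ order) (inverseʳ σ) (∈-map⁺ (σ ⟨$⟩ʳ_) (∈-allFin (σ ⟨$⟩ˡ v)))

mainTheorem1 : ∀ {n : ℕ} (G : Graph n) → 1 ≤ n →
    (σ : Permutation′ n) → IsDegeneracyOrdering G σ →
    (∃ λ out → BKDegeneracy G σ out) ×
    (∀ out → BKDegeneracy G σ out →
      (∀ C → C ∈ out → IsMaximalClique G C) ×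
      (∀ C → IsMaximalClique G C → timesReported G C out ≡ 1))
mainTheorem1 G 1≤n σ _ = run-outer order , correct
  where
  open Calls G using (maximal-nonempty)
  open Outer G σ
  correct : ∀ out → BKDegeneracy G σ out →
            (∀ C → C ∈ out → IsMaximalClique G C) ×
            (∀ C → IsMaximalClique G C → timesReported G C out ≡ 1)
  correct out run =
    (λ C C∈ → proj₁ (outer-sound run C∈)) ,
    (λ C mx → let (v , e) = earliest-exists (maximal-nonempty 1≤n mx)
              in outer-once order-unique run mx (∈-order v) e)
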